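{- Let $Q$ be a finite closed down set of pairs $\{c_j,s_k\}$ with associated $p,q,k$ and lengths $I_0,\dots,I_{k-1}$, $II_1,\dots,II_k$ as defined in the context. Then \[\sum_{j=1}^k II_j=p\qquad\text{and}\qquad \sum_{j=0}^{k-1}I_j=q-p.\]
   Context: $c_1,c_2,\dots$ and $s_1,s_2,\dots$ are distinct vertices; $[i]\times[j]$ denotes $\{\{c_a,s_b\}: a\le i, b\le j\}$. A set $Q$ of pairs $\{c_j,s_k\}$ is closed down if $\{c_a,s_b\}\in Q$ implies $\{c_{a'},s_{b'}\}\in Q$ for all $a'\le a$, $b'\le b$. For an integer $\ell\ge0$, $\nu(\ell,Q)$ is the matching number of the bipartite graph on $\{c_1,\dots,c_\ell\}\cup\{s_1,\dots,s_\ell\}$ with edge set $([\ell]\times[\ell])\setminus Q$. Let $p\ge0$ be the maximum integer with $[p]\times[p]\subseteq Q$, and $q\ge0$ the minimum integer such that $\nu(\ell,Q)=\ell$ for all $\ell\ge p+q$. For $\ell>p$ one has $\nu(\ell,Q)-\nu(\ell-1,Q)\in\{1,2\}$. The integer interval $(p,p+q]$ is divided into consecutive left-open, right-closed intervals with integer endpoints $\mathcal O_0,\mathcal T_1,\mathcal O_1,\mathcal T_2,\dots,\mathcal O_{k-1},\mathcal T_k$, in this order, all nonempty except possibly $\mathcal O_0$, such that $\nu(\ell,Q)-\nu(\ell-1,Q)=1$ for $\ell$ in any $\mathcal O_j$ and $=2$ for $\ell$ in any $\mathcal T_j$. Set $I_j=|\mathcal O_j|$ ($0\le j\le k-1$)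 and $II_j=|\mathcal T_j|$ ($1\le j\le k$). -}

module Defs where

open import Data.Nat using (ℕ; zero; suc; _+_; _∸_; _≤_; _<_)
open import Data.Bool using (Bool; true; false)
open import Data.Unit using (⊤)
open import Data.Product using (_×_; _,_; proj₁; proj₂; ∃; Σ)
open import Data.List using (List; []; _∷_; map; length)
open import Data.List.Relation.Unary.All using (All)
open import Data.List.Relation.Unary.Unique.Propositional using (Unique)
open import Relation.Binary.PropositionalEquality using (_≡_)
open import Relation.Nullary using (¬_)

-- Convention: indices are 0-based.  `Q a b` means {c_(a+1), s_(b+1)} ∈ Q.
PairSet : Set₁
PairSet = ℕ → ℕ → Set

ClosedDown : PairSet → Set
ClosedDown Q = ∀ a b a' b' → Q a b → a' ≤ a → b' ≤ b → Q a' b'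

Finite : PairSet → Set
Finite Q = ∃ λ N → ∀ a b → Q a b → (a < N) × (b < N)

BoxIn : ℕ → ℕ → PairSet → Set
BoxIn i j Q = ∀ a b → a < i → b < j → Q a b

-- edges of the bipartite graph on {c_1..c_ℓ} ∪ {s_1..s_ℓ} with edge set ([ℓ]×[ℓ]) \ Q
Edge : PairSet → ℕ → ℕ × ℕ → Set
Edge Q ℓ (a , b) = (a < ℓ) × (b < ℓ) × ¬ Q a b

IsMatching : PairSet → ℕ → List (ℕ × ℕ) → Set
IsMatching Q ℓ M = All (Edge Q ℓ) M × Unique (map proj₁ M) × Unique (map proj₂ M)

IsMatchingNumber : PairSet → ℕ → ℕ → Set
IsMatchingNumber Q ℓ m =
  (∃ λ M → IsMatching Q ℓ M × length M ≡ m) ×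
  (∀ M → IsMatching Q ℓ M → length M ≤ m)

IsP : PairSet → ℕ → Set
IsP Q p = BoxIn p p Q × (∀ p' → BoxIn p' p' Q → p' ≤ p)

PerfectFrom : PairSet → ℕ → Set
PerfectFrom Q n = ∀ ℓ → n ≤ ℓ → IsMatchingNumber Q ℓ ℓ

IsQ : PairSet → ℕ → ℕ → Set
IsQ Q p q = PerfectFrom Q (p + q) × (∀ q' → PerfectFrom Q (p + q') → q ≤ q')

-- ν(ℓ) - ν(ℓ-1) = n  (used for ℓ ≥ 1)
Diff : (ℕ → ℕ) → ℕ → ℕ → Set
Diff ν ℓ n = ν ℓ ≡ n + ν (ℓ ∸ 1)

-- Decomposition of (s, e] into O_0, T_1, O_1, T_2, …, O_(k-1), T_k.
-- The list holds the pairs (I_j , II_(j+1)) for j = 0 … k-1.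
-- The Bool flag says whether the current O-block is O_0 (allowed to be empty).
Decomp : (ℕ → ℕ) → ℕ → ℕ → Bool → List (ℕ × ℕ) → Set
Decomp ν s e first [] = s ≡ e
Decomp ν s e first ((a , b) ∷ bs) =
  (OkO first a) × (1 ≤ b) ×
  (∀ ℓ → s < ℓ → ℓ ≤ s + a → Diff ν ℓ 1) ×
  (∀ ℓ → s + a < ℓ → ℓ ≤ s + a + b → Diff ν ℓ 2) ×
  Decomp ν (s + a + b) e false bs
  where
  OkO : Bool → ℕ → Set
  OkO true  _ = ⊤
  OkO false x = 1 ≤ x

{-# OPTIONS --safe #-}
module Submission where

-- ν vanishes at p, since [p]×[p] ⊆ Q leaves no edges, and equals p + q at p + q,
-- where the matching is perfect.  Across (p, p + q] it grows by 1 on each O-block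
-- and by 2 on each T-block, so ΣI + 2ΣII = p + q, while the blocks tile the
-- interval, so ΣI + ΣII = q.  Subtracting gives ΣII = p and ΣI = q − p.

open import Defs
open import Data.Nat using (ℕ; zero; suc; _+_; _∸_; _≤_; _<_; _*_; s≤s; z≤n)
open import Data.Nat.Properties
open import Data.Bool using (true)
open import Data.Product using (_×_; _,_; proj₁; proj₂)
open import Data.List using (List; []; _∷_; map)
open import Data.List.Relation.Unary.All using (_∷_)
open import Data.Nat.ListAction using (sum)
open import Data.Nat.Tactic.RingSolver using (solve-∀)
open import Data.Empty using (⊥-elim)
open import Relation.Binary.PropositionalEquality

private
  variable
    Q : PairSet
    ℓ m m′ : ℕ

IsMatchingNumber-unique : IsMatchingNumber Q ℓ m → IsMatchingNumber Q ℓ m′ → m ≡ m′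
IsMatchingNumber-unique ((M , isM , |M|≡m) , maxm) ((M′ , isM′ , |M′|≡m′) , maxm′) =
  ≤-antisym (subst (_≤ _) |M|≡m (maxm′ M isM)) (subst (_≤ _) |M′|≡m′ (maxm M′ isM′))

BoxIn⇒matchingNumber≡0 : BoxIn ℓ ℓ Q → IsMatchingNumber Q ℓ m → m ≡ 0
BoxIn⇒matchingNumber≡0 box (([] , _ , |M|≡m) , _) = sym |M|≡m
BoxIn⇒matchingNumber≡0 box ((_ ∷ _ , ((a<ℓ , b<ℓ , ∉Q) ∷ _ , _) , _) , _) =
  ⊥-elim (∉Q (box _ _ a<ℓ b<ℓ))

constant-growth : (ν : ℕ → ℕ) (c s n : ℕ) →
  (∀ ℓ → s < ℓ → ℓ ≤ s + n → Diff ν ℓ c) → ν (s + n) ≡ n * c + ν s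
constant-growth ν c s zero _ = cong ν (+-identityʳ s)
constant-growth ν c s (suc n) step = begin
  ν (s + suc n)         ≡⟨ step (s + suc n) s<s+1+n ≤-refl ⟩
  c + ν (s + suc n ∸ 1) ≡⟨ cong (λ t → c + ν (t ∸ 1)) (+-suc s n) ⟩
  c + ν (s + n)         ≡⟨ cong (c +_) (constant-growth ν c s n earlier) ⟩
  c + (n * c + ν s)     ≡⟨ +-assoc c (n * c) (ν s) ⟨
  suc n * c + ν s       ∎
  where
  open ≡-Reasoning
  s<s+1+n : s < s + suc n
  s<s+1+n = m<m+n s (s≤s z≤n)
  earlier : ∀ ℓ → s < ℓ → ℓ ≤ s + n → Diff ν ℓ c
  earlier ℓ s<ℓ ℓ≤s+n = step ℓ s<ℓ (≤-trans ℓ≤s+n (+-monoʳ-≤ s (n≤1+n n)))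

Decomp-tiles : ∀ {ν s e f} bs → Decomp ν s e f bs →
  s + sum (map proj₁ bs) + sum (map proj₂ bs) ≡ e
Decomp-tiles {s = s} [] refl = trans (+-identityʳ (s + 0)) (+-identityʳ s)
Decomp-tiles {s = s} ((a , b) ∷ bs) (_ , _ , _ , _ , rest) =
  trans (regroup s a b (sum (map proj₁ bs)) (sum (map proj₂ bs))) (Decomp-tiles bs rest)
  where
  regroup : ∀ s a b A B → s + (a + A) + (b + B) ≡ s + a + b + A + B
  regroup = solve-∀

Decomp-growth : ∀ ν {s e f} bs → Decomp ν s e f bs →
  ν e ≡ sum (map proj₁ bs) + 2 * sum (map proj₂ bs) + ν s
Decomp-growth ν [] refl = refl
Decomp-growth ν {s} ((a , b) ∷ bs) (_ , _ , ones , twos , rest) = begin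
  ν _                                 ≡⟨ Decomp-growth ν bs rest ⟩
  A + 2 * B + ν (s + a + b)           ≡⟨ cong (A + 2 * B +_) (constant-growth ν 2 (s + a) b twos) ⟩
  A + 2 * B + (b * 2 + ν (s + a))     ≡⟨ cong (λ t → A + 2 * B + (b * 2 + t)) (constant-growth ν 1 s a ones) ⟩
  A + 2 * B + (b * 2 + (a * 1 + ν s)) ≡⟨ regroup a b A B (ν s) ⟩
  (a + A) + 2 * (b + B) + ν s         ∎
  where
  open ≡-Reasoning
  A = sum (map proj₁ bs)
  B = sum (map proj₂ bs)
  regroup : ∀ a b A B x → A + 2 * B + (b * 2 + (a * 1 + x)) ≡ (a + A) + 2 * (b + B) + x
  regroup = solve-∀

block-sums : ∀ p q A B → p + A + B ≡ p + q → A + 2 * B ≡ p + q →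
  (B ≡ p) × (p ≤ q) × (A ≡ q ∸ p)
block-sums p q A B tiles growth = B≡p , p≤q , A≡q∸p
  where
  A+B≡q : A + B ≡ q
  A+B≡q = +-cancelˡ-≡ p _ _ (trans (sym (+-assoc p A B)) tiles)
  B≡p : B ≡ p
  B≡p = +-cancelˡ-≡ q _ _ (begin
    q + B     ≡⟨ cong (_+ B) A+B≡q ⟨
    A + B + B ≡⟨ regroup A B ⟩
    A + 2 * B ≡⟨ growth ⟩
    p + q     ≡⟨ +-comm p q ⟩
    q + p     ∎)
    where
    open ≡-Reasoning
    regroup : ∀ A B → A + B + B ≡ A + 2 * B
    regroup = solve-∀
  A+p≡q : A + p ≡ q
  A+p≡q = trans (cong (A +_) (sym B≡p)) A+B≡q
  p≤q : p ≤ q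
  p≤q = subst (p ≤_) A+p≡q (m≤n+m p A)
  A≡q∸p : A ≡ q ∸ p
  A≡q∸p = trans (sym (m+n∸n≡m A p)) (cong (_∸ p) A+p≡q)

corollary4p7 : (Q : PairSet) → ClosedDown Q → Finite Q →
    (ν : ℕ → ℕ) → (∀ ℓ → IsMatchingNumber Q ℓ (ν ℓ)) →
    (p q : ℕ) → IsP Q p → IsQ Q p q →
    (blocks : List (ℕ × ℕ)) → Decomp ν p (p + q) true blocks →
    (sum (map proj₂ blocks) ≡ p) × (p ≤ q) × (sum (map proj₁ blocks) ≡ q ∸ p)
corollary4p7 Q _ _ ν isν p q (box , _) (perfect , _) blocks decomp =
  block-sums p q (sum (map proj₁ blocks)) (sum (map proj₂ blocks))
    (Decomp-tiles blocks decomp)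
    (begin
      A + 2 * B         ≡⟨ +-identityʳ _ ⟨
      A + 2 * B + 0     ≡⟨ cong (A + 2 * B +_) (BoxIn⇒matchingNumber≡0 box (isν p)) ⟨
      A + 2 * B + ν p   ≡⟨ Decomp-growth ν blocks decomp ⟨
      ν (p + q)         ≡⟨ IsMatchingNumber-unique (isν (p + q)) (perfect (p + q) ≤-refl) ⟩
      p + q             ∎)
  where
  open ≡-Reasoning
  A = sum (map proj₁ blocks)
  B = sum (map proj₂ blocks)
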